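{- Let $\mathcal T\in\Sigma^n$ be a text. The permutations $\pi,\bar\pi$ of $[n]$ defined by $\pi(i)=\mathrm{IPA}[i]$ and $\bar\pi(i)=n-\mathrm{IPA}[i]+1$ are order-preserving for $\mathcal T$. Furthermore, $|\mathtt{st\text{ - }colex}^-|\le\bar r$ and $|\mathtt{st\text{ - }colex}^+|\le\bar r$, where $\mathtt{st\text{ - }colex}^-=\mathrm{PDA}_\pi$ and $\mathtt{st\text{ - }colex}^+=\mathrm{PDA}_{\bar\pi}$.
   Context: A text is a string $\mathcal T\in\Sigma^n$ (1-indexed) whose last symbol $\$$ occurs only at position $n$ and is smaller than all other symbols. $\mathrm{IPA}[i]$ is the rank of the prefix $\mathcal T[1,i]$ in the colexicographic order of all prefixes of $\mathcal T$ (colexicographic order compares reversed strings lexicographically). The co-Burrows–Wheeler transform of $\mathcal T$ is obtained by sorting all rotations of $\mathcal T$ colexicographically and concatenating their first characters; $\bar r$ is its number of maximal equal-letter runs. $\mathrm{rlce}(i,j)$ is the length of the longest common prefix of $\mathcal T[i,n],\mathcal T[j,n]$. A permutation $\pi$ of $[n]$ is order-preserving for $\mathcal T$ if for all $i,j\in[n-1]$, $\pi(i)<\pi(j)$ and $\mathcal T[i,i+1]=\mathcal T[j,j+1]$ imply $\pi(i+1)<\pi(j+1)$. $\mathrm{LPF}_\pi[i]=0$ if $\pi(i)=1$, else $\max_{j:\pi(j)<\pi(i)}\mathrm{rlce}(j,i)$; $\mathrm{PDA}_\pi$ is the set of distinct values $\{i+\mathrm{LPF}_\pi[i]:i\in[n]\}$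 sorted colexicographically by the prefixes $\mathcal T[1,j]$. -}

module Defs where

open import Data.Nat using (ℕ; zero; suc; _+_; _∸_; _≤_; _<_; _⊔_; _≡ᵇ_; _<ᵇ_)
open import Data.Nat.Properties using (_≟_)
open import Data.Bool using (Bool; true; false; if_then_else_; _∧_; _∨_)
open import Data.List using (List; []; _∷_; length; take; drop; reverse; map; upTo; foldr; _++_; deduplicate)
open import Data.Product using (_×_)
open import Relation.Binary.PropositionalEquality using (_≡_)

-- Alphabet: ℕ with its usual order (any finite ordered alphabet embeds).
-- Texts are lists; positions are 1-indexed.

-- T[i] (1-indexed); default 0 outside [1,n] (never used there).
at : List ℕ → ℕ → ℕ
at [] _ = 0
at (x ∷ xs) zero = 0
at (x ∷ xs) (suc zero) = x
at (x ∷ xs) (suc (suc i)) = at xs (suc i)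

sub : List ℕ → ℕ → ℕ → List ℕ
sub T i j = take (suc j ∸ i) (drop (i ∸ 1) T)

pre : List ℕ → ℕ → List ℕ
pre T i = take i T

suf : List ℕ → ℕ → List ℕ
suf T i = drop (i ∸ 1) T

idx : ℕ → List ℕ
idx n = map suc (upTo n)

IsText : List ℕ → Set
IsText T = (1 ≤ length T) × (∀ i → 1 ≤ i → i < length T → at T (length T) < at T i)

lexLt : List ℕ → List ℕ → Bool
lexLt [] [] = false
lexLt [] (_ ∷ _) = true
lexLt (_ ∷ _) [] = false
lexLt (x ∷ xs) (y ∷ ys) = (x <ᵇ y) ∨ ((x ≡ᵇ y) ∧ lexLt xs ys)

colexLt : List ℕ → List ℕ → Bool
colexLt x y = lexLt (reverse x) (reverse y)

count : (ℕ → Bool) → List ℕ → ℕ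
count p [] = 0
count p (x ∷ xs) = (if p x then 1 else 0) + count p xs

IPA : List ℕ → ℕ → ℕ
IPA T i = suc (count (λ j → colexLt (pre T j) (pre T i)) (idx (length T)))

insertBy : {A : Set} → (A → A → Bool) → A → List A → List A
insertBy lt x [] = x ∷ []
insertBy lt x (y ∷ ys) = if lt x y then x ∷ y ∷ ys else y ∷ insertBy lt x ys

sortBy : {A : Set} → (A → A → Bool) → List A → List A
sortBy lt [] = []
sortBy lt (x ∷ xs) = insertBy lt x (sortBy lt xs)

rot : List ℕ → ℕ → List ℕ
rot T k = drop (k ∸ 1) T ++ take (k ∸ 1) T

headD : List ℕ → ℕ
headD [] = 0
headD (x ∷ _) = x

coBWT : List ℕ → List ℕ
coBWT T = map headD (sortBy colexLt (map (rot T) (idx (length T))))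

runs : List ℕ → ℕ
runs [] = 0
runs (x ∷ []) = 1
runs (x ∷ y ∷ xs) = (if x ≡ᵇ y then 0 else 1) + runs (y ∷ xs)

rbar : List ℕ → ℕ
rbar T = runs (coBWT T)

lcp : List ℕ → List ℕ → ℕ
lcp [] _ = 0
lcp (_ ∷ _) [] = 0
lcp (x ∷ xs) (y ∷ ys) = if x ≡ᵇ y then suc (lcp xs ys) else 0

rlce : List ℕ → ℕ → ℕ → ℕ
rlce T i j = lcp (suf T i) (suf T j)

IsPerm : ℕ → (ℕ → ℕ) → Set
IsPerm n π =
  (∀ i → 1 ≤ i → i ≤ n → (1 ≤ π i) × (π i ≤ n)) ×
  (∀ i j → 1 ≤ i → i ≤ n → 1 ≤ j → j ≤ n → π i ≡ π j → i ≡ j)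

OrderPreserving : List ℕ → (ℕ → ℕ) → Set
OrderPreserving T π = ∀ i j → 1 ≤ i → i < length T → 1 ≤ j → j < length T →
  π i < π j → sub T i (suc i) ≡ sub T j (suc j) → π (suc i) < π (suc j)

maxL : List ℕ → ℕ
maxL = foldr _⊔_ 0

LPF : List ℕ → (ℕ → ℕ) → ℕ → ℕ
LPF T π i with π i ≡ᵇ 1
... | true = 0
... | false = maxL (map (λ j → rlce T j i) (filterB (λ j → π j <ᵇ π i) (idx (length T))))
  where
  filterB : (ℕ → Bool) → List ℕ → List ℕ
  filterB p [] = []
  filterB p (x ∷ xs) = if p x then x ∷ filterB p xs else filterB p xs

PDA : List ℕ → (ℕ → ℕ) → List ℕ
PDA T π = sortBy (λ a b → colexLt (pre T a) (pre T b))
  (deduplicate _≟_ (map (λ i → i + LPF T π i) (idx (length T))))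

piIPA : List ℕ → ℕ → ℕ
piIPA T i = IPA T i

piBar : List ℕ → ℕ → ℕ
piBar T i = suc (length T) ∸ IPA T i

{-# OPTIONS --safe #-}

-- π and π̄ rank the positions by the colexicographic order of the prefixes ending there,
-- ascending and descending; appending one common letter preserves that order, which is
-- order preservation. The co-BWT lists the letters 𝒯[a+1] following the prefixes 𝒯[1,a],
-- 0 ≤ a < n, in colex order, because the sentinel makes rotations compare like these
-- prefixes. A value i + LPF[i] of PDA is a + 1 with a = i - 1 + LPF[i], and prefix a heads
-- a run. Indeed, let u be the prefix ending the earlier occurrence of the longest previous
-- factor W of i: u and a both end in W, u precedes a, and different letters follow them.
-- A prefix b preceding a, adjacent to it and followed by the same letter, would lie between
-- u and a, hence end in W as well; stripping W exhibits an earlier-ranked position whose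
-- match with i extends beyond LPF[i]. So distinct PDA values are distinct run heads. For π̄
-- the same argument runs on the reversed order and the reversed sorted list.
module Submission where

open import Defs
open import Level using (0ℓ)
open import Data.Nat using (ℕ; zero; suc; _+_; _≤_; _<_; s≤s⁻¹; _≡ᵇ_; _<ᵇ_; z≤n; s≤s)
open import Data.Nat.Properties
  using ( module ≤-Reasoning; _≟_; <-irrefl; <-asym; <-trans; <-cmp; ≤-trans; ≤-reflexive
        ; <⇒≤; <⇒≢; <⇒≱; n≮0; m<m+n; m≤n⇒m≤1+n; m≤m⊔n; m≤n⊔m; ⊔-sel; m≤n⇒m⊓n≡m
        ; +-comm; +-assoc; +-identityʳ; m<n⇒0<n∸m; ∸-monoʳ-≤; ∸-monoʳ-<; ∸-cancelˡ-≡; m+n∸n≡m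
        ; ≡ᵇ⇒≡; ≡⇒≡ᵇ; <ᵇ⇒<; <⇒<ᵇ )
open import Data.Bool using (Bool; true; false; T; if_then_else_; _∧_; _∨_)
open import Data.Bool.Properties using (T-≡; T-∨; T-∧; T?)
open import Data.List
  using (List; []; _∷_; _++_; _∷ʳ_; length; take; drop; reverse; map; upTo; filterᵇ; deduplicate)
open import Data.List.Properties
  using ( length-map; length-upTo; length-take; length-drop; length-++-sucʳ; map-∘; map-cong-local
        ; drop-drop; take++drop≡id; ++-assoc; ∷-injectiveˡ; ∷-injectiveʳ
        ; reverse-++; reverse-involutive; reverse-injective; reverse-map; unfold-reverse )
open import Data.List.Reverse using (reverseView; []; _∶_∶ʳ_)
open import Data.List.Relation.Binary.Lex.Strict
  using (Lex-<; base; halt; this; next; <-compare; <-transitive)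
open import Data.List.Relation.Binary.Pointwise using (Pointwise-≡⇒≡; ≡⇒Pointwise-≡)
open import Data.List.Relation.Binary.Permutation.Propositional
  using (_↭_; ↭-refl; ↭-prep; ↭-swap; ↭-trans; ↭-sym)
open import Data.List.Relation.Binary.Permutation.Propositional.Properties
  using (All-resp-↭; ∈-resp-↭; ↭-length)
open import Data.List.Relation.Binary.Subset.Propositional using (_⊆_)
open import Data.List.Relation.Unary.All as All using (All; []; _∷_)
import Data.List.Relation.Unary.All.Properties as Allₚ
open import Data.List.Relation.Unary.AllPairs as AllPairs using (AllPairs; []; _∷_)
import Data.List.Relation.Unary.AllPairs.Properties as AllPairs
open import Data.List.Relation.Unary.Any using (here; there)
import Data.List.Relation.Unary.Any.Properties as Any
open import Data.List.Relation.Unary.Unique.Propositional using (Unique)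
open import Data.List.Relation.Unary.Unique.DecPropositional.Properties using (deduplicate-!)
open import Data.List.Membership.Propositional using (_∈_)
open import Data.List.Membership.Propositional.Properties
  using ( ∈-map⁺; ∈-map⁻; ∈-upTo⁺; ∈-upTo⁻; ∈-filter⁺; ∈-filter⁻; ∈-deduplicate⁻
        ; ∈-∃++; ∈-++⁺ˡ; ∈-++⁺ʳ; ∈-++⁻ )
open import Data.Product using (_×_; _,_; ∃-syntax; proj₁; proj₂)
open import Data.Sum using (_⊎_; inj₁; inj₂)
open import Data.Empty using (⊥; ⊥-elim)
open import Function using (_∘_; flip; _⇔_; mk⇔; Equivalence)
open import Relation.Nullary using (¬_; yes; no)
open import Relation.Binary using (Rel; Transitive; Trichotomous; tri<; tri≈; tri>)
open import Relation.Binary.Consequences using (tri⇒irr)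
import Relation.Binary.Construct.Flip.EqAndOrd as Flip
open import Relation.Binary.PropositionalEquality
  using (_≡_; _≢_; refl; sym; trans; cong; cong₂; subst; subst₂; resp₂; isEquivalence; module ≡-Reasoning)

open Equivalence using (to; from)

¬T⇒≡false : ∀ {b} → ¬ T b → b ≡ false
¬T⇒≡false {false} _ = refl
¬T⇒≡false {true} ¬t = ⊥-elim (¬t _)

T-⇔⇒≡ : ∀ {a b} → T a ⇔ T b → a ≡ b
T-⇔⇒≡ {false} {false} _ = refl
T-⇔⇒≡ {false} {true} a⇔b = ⊥-elim (from a⇔b _)
T-⇔⇒≡ {true} {false} a⇔b = ⊥-elim (to a⇔b _)
T-⇔⇒≡ {true} {true} _ = refl

≡ᵇ-refl : ∀ m → (m ≡ᵇ m) ≡ true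
≡ᵇ-refl m = to T-≡ (≡⇒≡ᵇ m m refl)

≡ᵇ-sym : ∀ m n → (m ≡ᵇ n) ≡ (n ≡ᵇ m)
≡ᵇ-sym m n =
  T-⇔⇒≡ (mk⇔ (λ t → ≡⇒≡ᵇ n m (sym (≡ᵇ⇒≡ m n t))) (λ t → ≡⇒≡ᵇ m n (sym (≡ᵇ⇒≡ n m t))))

≢⇒≡ᵇ≡false : ∀ {m n} → m ≢ n → (m ≡ᵇ n) ≡ false
≢⇒≡ᵇ≡false {m} {n} m≢n = ¬T⇒≡false (m≢n ∘ ≡ᵇ⇒≡ m n)

-- Lexicographic and colexicographic orders

_<ₗₑₓ_ : Rel (List ℕ) 0ℓ
_<ₗₑₓ_ = Lex-< _≡_ _<_

lexLt⇒<ₗₑₓ : ∀ u v → T (lexLt u v) → u <ₗₑₓ v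
lexLt⇒<ₗₑₓ [] (y ∷ v) _ = halt
lexLt⇒<ₗₑₓ (x ∷ u) (y ∷ v) t with to T-∨ t
... | inj₁ x<y = this (<ᵇ⇒< x y x<y)
... | inj₂ t′ with to T-∧ t′
...   | x≡y , u<v = next (≡ᵇ⇒≡ x y x≡y) (lexLt⇒<ₗₑₓ u v u<v)

<ₗₑₓ⇒lexLt : ∀ {u v} → u <ₗₑₓ v → T (lexLt u v)
<ₗₑₓ⇒lexLt (base ())
<ₗₑₓ⇒lexLt halt = _
<ₗₑₓ⇒lexLt (this x<y) = from T-∨ (inj₁ (<⇒<ᵇ x<y))
<ₗₑₓ⇒lexLt {x ∷ _} (next refl u<v) =
  from T-∨ (inj₂ (from T-∧ (≡⇒≡ᵇ x x refl , <ₗₑₓ⇒lexLt u<v)))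

<ₗₑₓ-irrefl : ∀ {u} → ¬ u <ₗₑₓ u
<ₗₑₓ-irrefl (base ())
<ₗₑₓ-irrefl (this x<x) = <-irrefl refl x<x
<ₗₑₓ-irrefl (next _ u<u) = <ₗₑₓ-irrefl u<u

lexLt-irrefl : ∀ u → lexLt u u ≡ false
lexLt-irrefl u = ¬T⇒≡false (<ₗₑₓ-irrefl ∘ lexLt⇒<ₗₑₓ u u)

lexLt-sentinel : ∀ {d} u v {s t} → All (d <_) u → All (d <_) v → u ≢ v →
                 lexLt (u ++ d ∷ s) (v ++ d ∷ t) ≡ lexLt u v
lexLt-sentinel [] [] _ _ u≢v = ⊥-elim (u≢v refl)
lexLt-sentinel [] (y ∷ v) _ (d<y ∷ _) _ rewrite to T-≡ (<⇒<ᵇ d<y) = refl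
lexLt-sentinel {d} (x ∷ u) [] (d<x ∷ _) _ _
  rewrite ¬T⇒≡false (<-asym d<x ∘ <ᵇ⇒< x d) | ≢⇒≡ᵇ≡false (<⇒≢ d<x ∘ sym) = refl
lexLt-sentinel (x ∷ u) (y ∷ v) (_ ∷ d<u) (_ ∷ d<v) u≢v with x ≟ y
... | yes refl = cong (λ b → (x <ᵇ x) ∨ ((x ≡ᵇ x) ∧ b)) (lexLt-sentinel u v d<u d<v (u≢v ∘ cong (x ∷_)))
... | no x≢y rewrite ≢⇒≡ᵇ≡false x≢y = refl

lex-++⁺ : ∀ w {u v} → u <ₗₑₓ v → (w ++ u) <ₗₑₓ (w ++ v)
lex-++⁺ [] u<v = u<v
lex-++⁺ (c ∷ w) u<v = next refl (lex-++⁺ w u<v)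

lex-++⁻ : ∀ w {u v} → (w ++ u) <ₗₑₓ (w ++ v) → u <ₗₑₓ v
lex-++⁻ [] u<v = u<v
lex-++⁻ (c ∷ w) (this c<c) = ⊥-elim (<-irrefl refl c<c)
lex-++⁻ (c ∷ w) (next _ u<v) = lex-++⁻ w u<v

lex-convex : ∀ w {x y z} → (w ++ x) <ₗₑₓ y → y <ₗₑₓ (w ++ z) → ∃[ q ] y ≡ w ++ q
lex-convex [] {y = y} _ _ = y , refl
lex-convex (c ∷ w) (this c<b) (this b<c) = ⊥-elim (<-asym c<b b<c)
lex-convex (c ∷ w) (this c<c) (next refl _) = ⊥-elim (<-irrefl refl c<c)
lex-convex (c ∷ w) (next refl _) (this c<c) = ⊥-elim (<-irrefl refl c<c)
lex-convex (c ∷ w) (next refl p) (next refl q) with lex-convex w p q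
... | r , refl = r , refl

Colex : Rel (List ℕ) 0ℓ
Colex u v = reverse u <ₗₑₓ reverse v

colexLt⇔Colex : ∀ u v → T (colexLt u v) ⇔ Colex u v
colexLt⇔Colex u v = mk⇔ (lexLt⇒<ₗₑₓ (reverse u) (reverse v)) <ₗₑₓ⇒lexLt

record IsSuffixCompatible (_⊏_ : Rel (List ℕ) 0ℓ) : Set where
  field
    compare    : Trichotomous _≡_ _⊏_
    transitive : Transitive _⊏_
    extend     : ∀ w {u v} → u ⊏ v → (u ++ w) ⊏ (v ++ w)
    cancel     : ∀ w {u v} → (u ++ w) ⊏ (v ++ w) → u ⊏ v
    convex     : ∀ w {x y z} → (x ++ w) ⊏ y → y ⊏ (z ++ w) → ∃[ p ] y ≡ p ++ w

  irrefl : ∀ {u} → ¬ u ⊏ u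
  irrefl = tri⇒irr compare refl

colex-isSuffixCompatible : IsSuffixCompatible Colex
colex-isSuffixCompatible = record
  { compare    = compare
  ; transitive = <-transitive isEquivalence (resp₂ _<_) <-trans
  ; extend     = λ w {u} {v} u<v →
      subst₂ _<ₗₑₓ_ (sym (reverse-++ u w)) (sym (reverse-++ v w)) (lex-++⁺ (reverse w) u<v)
  ; cancel     = λ w {u} {v} uw<vw →
      lex-++⁻ (reverse w) (subst₂ _<ₗₑₓ_ (reverse-++ u w) (reverse-++ v w) uw<vw)
  ; convex     = convex
  }
  where
  compare : Trichotomous _≡_ Colex
  compare u v with <-compare sym <-cmp (reverse u) (reverse v)
  ... | tri< a ¬b ¬c = tri< a (¬b ∘ ≡⇒Pointwise-≡ ∘ cong reverse) ¬c
  ... | tri≈ ¬a b ¬c = tri≈ ¬a (trans (sym (reverse-involutive u))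
                                  (trans (cong reverse (Pointwise-≡⇒≡ b)) (reverse-involutive v))) ¬c
  ... | tri> ¬a ¬b c = tri> ¬a (¬b ∘ ≡⇒Pointwise-≡ ∘ cong reverse) c

  convex : ∀ w {x y z} → Colex (x ++ w) y → Colex y (z ++ w) → ∃[ p ] y ≡ p ++ w
  convex w {x} {y} {z} xw<y y<zw
    with lex-convex (reverse w) (subst (_<ₗₑₓ reverse y) (reverse-++ x w) xw<y)
                                (subst (reverse y <ₗₑₓ_) (reverse-++ z w) y<zw)
  ... | q , ry≡ = reverse q , (begin
        y                              ≡⟨ sym (reverse-involutive y) ⟩
        reverse (reverse y)            ≡⟨ cong reverse ry≡ ⟩
        reverse (reverse w ++ q)       ≡⟨ reverse-++ (reverse w) q ⟩
        reverse q ++ reverse (reverse w) ≡⟨ cong (reverse q ++_) (reverse-involutive w) ⟩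
        reverse q ++ w                 ∎)
    where open ≡-Reasoning

flip-isSuffixCompatible : ∀ {_⊏_} → IsSuffixCompatible _⊏_ → IsSuffixCompatible (flip _⊏_)
flip-isSuffixCompatible {_⊏_} O = record
  { compare    = Flip.compare _⊏_ compare
  ; transitive = Flip.trans _⊏_ transitive
  ; extend     = λ w → extend w
  ; cancel     = λ w → cancel w
  ; convex     = λ w p q → convex w q p
  }
  where open IsSuffixCompatible O

module _ {A : Set} (lt : A → A → Bool) where

  insertBy-↭ : ∀ x ys → insertBy lt x ys ↭ x ∷ ys
  insertBy-↭ x [] = ↭-refl
  insertBy-↭ x (y ∷ ys) with lt x y
  ... | true = ↭-refl
  ... | false = ↭-trans (↭-prep y (insertBy-↭ x ys)) (↭-swap y x ↭-refl)

  sortBy-↭ : ∀ xs → sortBy lt xs ↭ xs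
  sortBy-↭ [] = ↭-refl
  sortBy-↭ (x ∷ xs) = ↭-trans (insertBy-↭ x (sortBy lt xs)) (↭-prep x (sortBy-↭ xs))

  module _ {_<_ : Rel A 0ℓ} (lt⇔< : ∀ {x y} → T (lt x y) ⇔ x < y) (<-transitive : Transitive _<_) where

    Comparable : Rel A 0ℓ
    Comparable x y = x < y ⊎ y < x

    insertBy-sorted : ∀ {x ys} → All (Comparable x) ys → AllPairs _<_ ys → AllPairs _<_ (insertBy lt x ys)
    insertBy-sorted {x} {[]} _ _ = [] ∷ []
    insertBy-sorted {x} {y ∷ ys} (x~y ∷ x~ys) (y<ys ∷ ys-sorted) with lt x y in eq
    ... | true = (x<y ∷ All.map (<-transitive x<y) y<ys) ∷ y<ys ∷ ys-sorted
      where x<y = to lt⇔< (from T-≡ eq)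
    ... | false = All-resp-↭ (↭-sym (insertBy-↭ x ys)) (y<x x~y ∷ y<ys) ∷ insertBy-sorted x~ys ys-sorted
      where
      y<x : Comparable x y → y < x
      y<x (inj₁ x<y) = ⊥-elim (subst T eq (from lt⇔< x<y))
      y<x (inj₂ y<x) = y<x

    sortBy-sorted : ∀ {xs} → AllPairs Comparable xs → AllPairs _<_ (sortBy lt xs)
    sortBy-sorted {[]} _ = []
    sortBy-sorted {x ∷ xs} (x~xs ∷ xs~) =
      insertBy-sorted (All-resp-↭ (↭-sym (sortBy-↭ xs)) x~xs) (sortBy-sorted xs~)

module _ {A B : Set} (h : A → B) (ltB : B → B → Bool) (ltA : A → A → Bool) {P : A → Set}
         (h-preserves : ∀ {x y} → P x → P y → ltB (h x) (h y) ≡ ltA x y) where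

  insertBy-map : ∀ {x ys} → P x → All P ys → insertBy ltB (h x) (map h ys) ≡ map h (insertBy ltA x ys)
  insertBy-map {x} {[]} _ _ = refl
  insertBy-map {x} {y ∷ ys} px (py ∷ pys) rewrite h-preserves px py with ltA x y
  ... | true = refl
  ... | false = cong (h y ∷_) (insertBy-map px pys)

  sortBy-map : ∀ {xs} → All P xs → sortBy ltB (map h xs) ≡ map h (sortBy ltA xs)
  sortBy-map {[]} _ = refl
  sortBy-map {x ∷ xs} (px ∷ pxs) =
    trans (cong (insertBy ltB (h x)) (sortBy-map pxs))
          (insertBy-map px (All-resp-↭ (↭-sym (sortBy-↭ ltA xs)) pxs))

module _ (p q : ℕ → Bool) where

  count-≤ : ∀ xs → (∀ {x} → x ∈ xs → T (p x) → T (q x)) → count p xs ≤ count q xs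
  count-≤ [] _ = z≤n
  count-≤ (x ∷ xs) p⇒q with p x in px | q x in qx
  ... | true  | true  = s≤s (count-≤ xs (p⇒q ∘ there))
  ... | true  | false = ⊥-elim (subst T qx (p⇒q (here refl) (from T-≡ px)))
  ... | false | true  = m≤n⇒m≤1+n (count-≤ xs (p⇒q ∘ there))
  ... | false | false = count-≤ xs (p⇒q ∘ there)

  count-< : ∀ xs → (∀ {x} → x ∈ xs → T (p x) → T (q x)) →
            ∀ {z} → z ∈ xs → ¬ T (p z) → T (q z) → count p xs < count q xs
  count-< (x ∷ xs) p⇒q (here refl) ¬pz qz with p x | q x
  ... | true  | _     = ⊥-elim (¬pz _)
  ... | false | false = ⊥-elim qz
  ... | false | true  = s≤s (count-≤ xs (p⇒q ∘ there))
  count-< (x ∷ xs) p⇒q (there z∈xs) ¬pz qz with p x in px | q x in qx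
  ... | true  | true  = s≤s (count-< xs (p⇒q ∘ there) z∈xs ¬pz qz)
  ... | true  | false = ⊥-elim (subst T qx (p⇒q (here refl) (from T-≡ px)))
  ... | false | true  = m≤n⇒m≤1+n (count-< xs (p⇒q ∘ there) z∈xs ¬pz qz)
  ... | false | false = count-< xs (p⇒q ∘ there) z∈xs ¬pz qz

count-true : ∀ xs → count (λ _ → true) xs ≡ length xs
count-true [] = refl
count-true (x ∷ xs) = cong suc (count-true xs)

-- Runs

boundary : ℕ → ℕ → ℕ
boundary x y = if x ≡ᵇ y then 0 else 1

runs-++-∷-∷ : ∀ xs x y → runs (xs ++ x ∷ y ∷ []) ≡ runs (xs ++ x ∷ []) + boundary x y
runs-++-∷-∷ [] x y = +-comm (boundary x y) 1
runs-++-∷-∷ (z ∷ []) x y =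
  trans (cong (boundary z x +_) (runs-++-∷-∷ [] x y)) (sym (+-assoc (boundary z x) 1 (boundary x y)))
runs-++-∷-∷ (z ∷ z′ ∷ zs) x y =
  trans (cong (boundary z z′ +_) (runs-++-∷-∷ (z′ ∷ zs) x y))
        (sym (+-assoc (boundary z z′) (runs (z′ ∷ zs ++ x ∷ [])) (boundary x y)))

runs-reverse : ∀ xs → runs (reverse xs) ≡ runs xs
runs-reverse [] = refl
runs-reverse (x ∷ []) = refl
runs-reverse (x ∷ y ∷ xs) = begin
  runs (reverse (x ∷ y ∷ xs))         ≡⟨ cong runs (unfold-reverse x (y ∷ xs)) ⟩
  runs (reverse (y ∷ xs) ∷ʳ x)        ≡⟨ cong (λ r → runs (r ∷ʳ x)) (unfold-reverse y xs) ⟩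
  runs ((reverse xs ∷ʳ y) ∷ʳ x)       ≡⟨ cong runs (++-assoc (reverse xs) (y ∷ []) (x ∷ [])) ⟩
  runs (reverse xs ++ y ∷ x ∷ [])     ≡⟨ runs-++-∷-∷ (reverse xs) y x ⟩
  runs (reverse xs ∷ʳ y) + boundary y x
    ≡⟨ cong₂ _+_ (trans (cong runs (sym (unfold-reverse y xs))) (runs-reverse (y ∷ xs)))
                 (cong (λ b → if b then 0 else 1) (≡ᵇ-sym y x)) ⟩
  runs (y ∷ xs) + boundary x y        ≡⟨ +-comm (runs (y ∷ xs)) (boundary x y) ⟩
  runs (x ∷ y ∷ xs)                   ∎
  where open ≡-Reasoning

module _ (g : ℕ → ℕ) where

  runHeadsAfter : ℕ → List ℕ → List ℕ
  runHeadsAfter p [] = []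
  runHeadsAfter p (y ∷ ys) = if g p ≡ᵇ g y then runHeadsAfter y ys else y ∷ runHeadsAfter y ys

  runHeads : List ℕ → List ℕ
  runHeads [] = []
  runHeads (x ∷ xs) = x ∷ runHeadsAfter x xs

  length-runHeadsAfter : ∀ p xs → suc (length (runHeadsAfter p xs)) ≡ runs (g p ∷ map g xs)
  length-runHeadsAfter p [] = refl
  length-runHeadsAfter p (y ∷ ys) with g p ≡ᵇ g y
  ... | true = length-runHeadsAfter y ys
  ... | false = cong suc (length-runHeadsAfter y ys)

  length-runHeads : ∀ xs → length (runHeads xs) ≡ runs (map g xs)
  length-runHeads [] = refl
  length-runHeads (x ∷ xs) = length-runHeadsAfter x xs

  ∈-runHeadsAfter : ∀ {a} p xs → a ∈ xs →
    (∀ ini b post → p ∷ xs ≡ ini ++ b ∷ a ∷ post → g b ≢ g a) → a ∈ runHeadsAfter p xs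
  ∈-runHeadsAfter p (y ∷ ys) (here refl) new rewrite ≢⇒≡ᵇ≡false (new [] p ys refl) = here refl
  ∈-runHeadsAfter p (y ∷ ys) (there a∈ys) new with g p ≡ᵇ g y
  ... | true = a∈
    where a∈ = ∈-runHeadsAfter y ys a∈ys (λ ini b post → new (p ∷ ini) b post ∘ cong (p ∷_))
  ... | false = there a∈
    where a∈ = ∈-runHeadsAfter y ys a∈ys (λ ini b post → new (p ∷ ini) b post ∘ cong (p ∷_))

  ∈-runHeads : ∀ {a} xs → a ∈ xs →
    (∀ ini b post → xs ≡ ini ++ b ∷ a ∷ post → g b ≢ g a) → a ∈ runHeads xs
  ∈-runHeads (x ∷ xs) (here refl) _ = here refl
  ∈-runHeads (x ∷ xs) (there a∈xs) new = there (∈-runHeadsAfter x xs a∈xs new)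

HeadsRun : Rel ℕ 0ℓ → (ℕ → ℕ) → (ℕ → Set) → ℕ → Set
HeadsRun _<_ g P a = ∀ {b} → P b → b < a → g b ≡ g a → ∃[ m ] P m × b < m × m < a

module _ {_≺_ : Rel ℕ 0ℓ} (≺-irrefl : ∀ {x} → ¬ x ≺ x) (≺-trans : Transitive _≺_) where

  neighbours-ordered : ∀ ini {b a post} → AllPairs _≺_ (ini ++ b ∷ a ∷ post) → b ≺ a
  neighbours-ordered [] ((b≺a ∷ _) ∷ _) = b≺a
  neighbours-ordered (_ ∷ ini) (_ ∷ sorted) = neighbours-ordered ini sorted

  nothing-between-neighbours : ∀ ini {b a post m} → AllPairs _≺_ (ini ++ b ∷ a ∷ post) →
    m ∈ ini ++ b ∷ a ∷ post → b ≺ m → m ≺ a → ⊥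
  nothing-between-neighbours [] _ (here refl) b≺b _ = ≺-irrefl b≺b
  nothing-between-neighbours [] _ (there (here refl)) _ a≺a = ≺-irrefl a≺a
  nothing-between-neighbours [] (_ ∷ a≺post ∷ _) (there (there m∈post)) _ m≺a =
    ≺-irrefl (≺-trans (All.lookup a≺post m∈post) m≺a)
  nothing-between-neighbours (x ∷ ini) (x≺rest ∷ _) (here refl) b≺x _ =
    ≺-irrefl (≺-trans b≺x (All.lookup x≺rest (∈-++⁺ʳ ini (here refl))))
  nothing-between-neighbours (x ∷ ini) (_ ∷ sorted) (there m∈) = nothing-between-neighbours ini sorted m∈

  heads-run⇒∈-runHeads : ∀ g {P a} S → AllPairs _≺_ S → (∀ {x} → x ∈ S ⇔ P x) →
    a ∈ S → HeadsRun _≺_ g P a → a ∈ runHeads g S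
  heads-run⇒∈-runHeads g {a = a} S sorted S⇔P a∈S heads = ∈-runHeads g S a∈S new
    where
    new : ∀ ini b post → S ≡ ini ++ b ∷ a ∷ post → g b ≢ g a
    new ini b post refl gb≡ga
      with m , Pm , b≺m , m≺a ←
             heads (to S⇔P (∈-++⁺ʳ ini (here refl))) (neighbours-ordered ini sorted) gb≡ga
      = nothing-between-neighbours ini sorted (from S⇔P Pm) b≺m m≺a

AllPairs-reverse : ∀ {A : Set} {R : Rel A 0ℓ} {xs} → AllPairs R xs → AllPairs (flip R) (reverse xs)
AllPairs-reverse {xs = []} [] = []
AllPairs-reverse {R = R} {xs = x ∷ xs} (x<xs ∷ sorted) =
  subst (AllPairs (flip R)) (sym (unfold-reverse x xs))
    (AllPairs.++⁺ (AllPairs-reverse sorted) ([] ∷ [])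
      (All.tabulate (λ y∈ → All.lookup x<xs (Any.reverse⁻ y∈) ∷ [])))

Unique-⊆⇒length-≤ : ∀ {D L : List ℕ} → Unique D → D ⊆ L → length D ≤ length L
Unique-⊆⇒length-≤ {[]} _ _ = z≤n
Unique-⊆⇒length-≤ {x ∷ D} (x∉D ∷ D!) D⊆L with L₁ , L₂ , refl ← ∈-∃++ (D⊆L (here refl)) =
  ≤-trans (s≤s (Unique-⊆⇒length-≤ D! (λ y∈D → remove-x (All.lookup x∉D y∈D) (D⊆L (there y∈D)))))
          (≤-reflexive (sym (length-++-sucʳ L₁ x L₂)))
  where
  remove-x : ∀ {y} → x ≢ y → y ∈ L₁ ++ x ∷ L₂ → y ∈ L₁ ++ L₂
  remove-x x≢y y∈ with ∈-++⁻ L₁ y∈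
  ... | inj₁ y∈L₁ = ∈-++⁺ˡ y∈L₁
  ... | inj₂ (here refl) = ⊥-elim (x≢y refl)
  ... | inj₂ (there y∈L₂) = ∈-++⁺ʳ L₁ y∈L₂

-- Longest previous factors

≤-maxL : ∀ {x xs} → x ∈ xs → x ≤ maxL xs
≤-maxL {xs = x ∷ xs} (here refl) = m≤m⊔n x (maxL xs)
≤-maxL {xs = y ∷ xs} (there x∈xs) = ≤-trans (≤-maxL x∈xs) (m≤n⊔m y (maxL xs))

maxL-attained : ∀ xs → maxL xs ≡ 0 ⊎ maxL xs ∈ xs
maxL-attained [] = inj₁ refl
maxL-attained (x ∷ xs) with ⊔-sel x (maxL xs)
... | inj₁ max≡x = inj₂ (here max≡x)
... | inj₂ max≡rest with maxL-attained xs
...   | inj₁ rest≡0 = inj₁ (trans max≡rest rest≡0)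
...   | inj₂ rest∈xs = inj₂ (there (subst (_∈ xs) (sym max≡rest) rest∈xs))

-- Defs.LPF filters through a function local to its where-block, which cannot be
-- named here; the mutual block recovers it by unification.
mutual
  lpfFilter : (ℕ → ℕ) → ℕ → List ℕ → (ℕ → Bool) → List ℕ → List ℕ
  lpfFilter = _

  LPF-cases′ : ∀ T π i → (π i ≡ 1 × LPF T π i ≡ 0) ⊎
    LPF T π i ≡ maxL (map (λ j → rlce T j i) (lpfFilter π i T (λ j → π j <ᵇ π i) (idx (length T))))
  LPF-cases′ T π i with π i ≡ᵇ 1 in πi≡1
  ... | true = inj₁ (≡ᵇ⇒≡ (π i) 1 (from T-≡ πi≡1) , refl)
  ... | false with (λ j → π j <ᵇ π i) | idx (length T) | map {A = ℕ} (λ j → rlce T j i)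
  ...   | p | L | m = inj₂ refl

lpfFilter≡filterᵇ : ∀ π i T p xs → lpfFilter π i T p xs ≡ filterᵇ p xs
lpfFilter≡filterᵇ π i T p [] = refl
lpfFilter≡filterᵇ π i T p (x ∷ xs) with p x
... | true = cong (x ∷_) (lpfFilter≡filterᵇ π i T p xs)
... | false = lpfFilter≡filterᵇ π i T p xs

LPF-cases : ∀ T π i → (π i ≡ 1 × LPF T π i ≡ 0) ⊎
  LPF T π i ≡ maxL (map (λ j → rlce T j i) (filterᵇ (λ j → π j <ᵇ π i) (idx (length T))))
LPF-cases T π i with LPF-cases′ T π i
... | inj₁ first = inj₁ first
... | inj₂ LPF≡ = inj₂ (trans LPF≡ (cong (maxL ∘ map (λ j → rlce T j i))
                                        (lpfFilter≡filterᵇ π i T (λ j → π j <ᵇ π i) (idx (length T)))))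

module _ {A : Set} where

  length-∷ʳ : ∀ (xs : List A) x → length (xs ∷ʳ x) ≡ suc (length xs)
  length-∷ʳ [] x = refl
  length-∷ʳ (_ ∷ xs) x = cong suc (length-∷ʳ xs x)

  take-length-++ : ∀ (xs ys : List A) → take (length xs) (xs ++ ys) ≡ xs
  take-length-++ [] ys = refl
  take-length-++ (x ∷ xs) ys = cong (x ∷_) (take-length-++ xs ys)

  drop-length-++ : ∀ (xs ys : List A) → drop (length xs) (xs ++ ys) ≡ ys
  drop-length-++ [] ys = refl
  drop-length-++ (x ∷ xs) ys = drop-length-++ xs ys

  take-++ : ∀ {k} (xs ys : List A) → k ≤ length xs → take k (xs ++ ys) ≡ take k xs
  take-++ {zero} xs ys _ = refl
  take-++ {suc k} (x ∷ xs) ys (s≤s k≤) = cong (x ∷_) (take-++ xs ys k≤)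

  drop-++ : ∀ {k} (xs ys : List A) → k ≤ length xs → drop k (xs ++ ys) ≡ drop k xs ++ ys
  drop-++ {zero} xs ys _ = refl
  drop-++ {suc k} (x ∷ xs) ys (s≤s k≤) = drop-++ xs ys k≤

  length-take-≤ : ∀ {k} (xs : List A) → k ≤ length xs → length (take k xs) ≡ k
  length-take-≤ xs k≤ = trans (length-take _ xs) (m≤n⇒m⊓n≡m k≤)

  take-after : ∀ (xs : List A) k {w s} → drop k xs ≡ w ++ s → take (k + length w) xs ≡ take k xs ++ w
  take-after xs zero {w} {s} refl = take-length-++ w s
  take-after [] (suc k) {[]} _ = refl
  take-after (x ∷ xs) (suc k) e = cong (x ∷_) (take-after xs k e)

  drop-after : ∀ (xs : List A) k {w s} → drop k xs ≡ w ++ s → drop (k + length w) xs ≡ s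
  drop-after xs k {w} {s} e =
    trans (sym (drop-drop k (length w) xs)) (trans (cong (drop (length w)) e) (drop-length-++ w s))

  split-after-prefix : ∀ (xs : List A) b {p w} → take b xs ≡ p ++ w →
                       take (length p) xs ≡ p × drop (length p) xs ≡ w ++ drop b xs
  split-after-prefix xs b {p} {w} e =
    trans (cong (take (length p)) xs≡) (take-length-++ p _) ,
    trans (cong (drop (length p)) xs≡) (drop-length-++ p _)
    where
    xs≡ : xs ≡ p ++ w ++ drop b xs
    xs≡ = trans (sym (take++drop≡id b xs)) (trans (cong (_++ drop b xs) e) (++-assoc p w (drop b xs)))

  ∈-before-last : ∀ (us vs : List A) {x y z r} → us ∷ʳ y ≡ vs ++ x ∷ z ∷ r → x ∈ us
  ∈-before-last [] [] ()
  ∈-before-last [] (_ ∷ []) ()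
  ∈-before-last [] (_ ∷ _ ∷ _) ()
  ∈-before-last (u ∷ us) [] e = here (sym (∷-injectiveˡ e))
  ∈-before-last (u ∷ us) (v ∷ vs) e = there (∈-before-last us vs (∷-injectiveʳ e))

drop-at : ∀ (xs : List ℕ) {k} → k < length xs → drop k xs ≡ at xs (suc k) ∷ drop (suc k) xs
drop-at (x ∷ xs) {zero} _ = refl
drop-at (x ∷ xs) {suc k} (s≤s k<) = drop-at xs k<

take-at : ∀ (xs : List ℕ) {k} → k < length xs → take (suc k) xs ≡ take k xs ∷ʳ at xs (suc k)
take-at (x ∷ xs) {zero} _ = refl
take-at (x ∷ xs) {suc k} (s≤s k<) = cong (x ∷_) (take-at xs k<)

drop-∷ : ∀ (xs : List ℕ) k {z r} → drop k xs ≡ z ∷ r → k < length xs × at xs (suc k) ≡ z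
drop-∷ (x ∷ xs) zero refl = s≤s z≤n , refl
drop-∷ (x ∷ xs) (suc k) e with k< , at≡ ← drop-∷ xs k e = s≤s k< , at≡

at-last : ∀ (xs : List ℕ) x → at (xs ∷ʳ x) (suc (length xs)) ≡ x
at-last [] x = refl
at-last (_ ∷ xs) x = at-last xs x

All-at : ∀ {P : ℕ → Set} xs ys → (∀ i → 1 ≤ i → i ≤ length xs → P (at (xs ++ ys) i)) → All P xs
All-at [] ys _ = []
All-at (x ∷ xs) ys P-at = P-at 1 (s≤s z≤n) (s≤s z≤n) ∷ All-at xs ys λ where
  (suc i) _ i≤ → P-at (suc (suc i)) (s≤s z≤n) (s≤s i≤)

lcp-++ : ∀ w s t → lcp (w ++ s) (w ++ t) ≡ length w + lcp s t
lcp-++ [] s t = refl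
lcp-++ (c ∷ w) s t rewrite ≡ᵇ-refl c = cong suc (lcp-++ w s t)

lcp-≢ : ∀ {x y} s t → x ≢ y → lcp (x ∷ s) (y ∷ t) ≡ 0
lcp-≢ s t x≢y rewrite ≢⇒≡ᵇ≡false x≢y = refl

record Mismatch (s t : List ℕ) : Set where
  constructor mismatch
  field
    common : List ℕ
    {x y}  : ℕ
    {s′ t′} : List ℕ
    x≢y    : x ≢ y
    s≡     : s ≡ common ++ x ∷ s′
    t≡     : t ≡ common ++ y ∷ t′

  lcp≡ : lcp s t ≡ length common
  lcp≡ rewrite s≡ | t≡ | lcp-++ common (x ∷ s′) (y ∷ t′) | lcp-≢ s′ t′ x≢y =
    +-identityʳ (length common)

first-mismatch : ∀ s t → s ≢ t → (∀ {z r} → t ≢ s ++ z ∷ r) → (∀ {z r} → s ≢ t ++ z ∷ r) →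
                 Mismatch s t
first-mismatch [] [] s≢t _ _ = ⊥-elim (s≢t refl)
first-mismatch [] (y ∷ t) _ t≢s++ _ = ⊥-elim (t≢s++ refl)
first-mismatch (x ∷ s) [] _ _ s≢t++ = ⊥-elim (s≢t++ refl)
first-mismatch (x ∷ s) (y ∷ t) s≢t t≢s++ s≢t++ with x ≟ y
... | no x≢y = mismatch [] x≢y refl refl
... | yes refl with first-mismatch s t (s≢t ∘ cong (x ∷_)) (t≢s++ ∘ cong (x ∷_)) (s≢t++ ∘ cong (x ∷_))
...   | mismatch w a≢b s≡ t≡ = mismatch (x ∷ w) a≢b (cong (x ∷_) s≡) (cong (x ∷_) t≡)

-- Texts ending with a unique smallest letter

split-sentinel : ∀ {T} → IsText T → ∃[ T′ ] ∃[ d ] T ≡ T′ ∷ʳ d × All (d <_) T′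
split-sentinel {T} (nonempty , last<) with reverseView T
... | [] = ⊥-elim (n≮0 nonempty)
... | T′ ∶ _ ∶ʳ d = T′ , d , refl , All-at T′ (d ∷ []) λ i 1≤i i≤ →
  subst (_< at (T′ ∷ʳ d) i) last≡d (last< i 1≤i (subst (i <_) (sym (length-∷ʳ T′ d)) (s≤s i≤)))
  where
  last≡d : at (T′ ∷ʳ d) (length (T′ ∷ʳ d)) ≡ d
  last≡d = trans (cong (at (T′ ∷ʳ d)) (length-∷ʳ T′ d)) (at-last T′ d)

-- Positions are 0-based: a prefix is named by its length a (it is 𝒯[1,a] and is followed
-- by letter a = 𝒯[a+1]), a suffix by the number i0 of letters before it; position i of the
-- paper is suc i0.
module Text (T′ : List ℕ) (d : ℕ) (d<T′ : All (d <_) T′) where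

  𝒯 : List ℕ
  𝒯 = T′ ∷ʳ d

  n : ℕ
  n = length 𝒯

  letter : ℕ → ℕ
  letter k = at 𝒯 (suc k)

  lce : ℕ → ℕ → ℕ
  lce j0 i0 = lcp (drop j0 𝒯) (drop i0 𝒯)

  <n⇒≤∣T′∣ : ∀ {k} → k < n → k ≤ length T′
  <n⇒≤∣T′∣ {k} k<n = s≤s⁻¹ (subst (k <_) (length-∷ʳ T′ d) k<n)

  drop-𝒯 : ∀ {k} → k < n → drop k 𝒯 ≡ drop k T′ ∷ʳ d
  drop-𝒯 k<n = drop-++ T′ (d ∷ []) (<n⇒≤∣T′∣ k<n)

  take-𝒯 : ∀ {k} → k < n → take k 𝒯 ≡ take k T′
  take-𝒯 k<n = take-++ T′ (d ∷ []) (<n⇒≤∣T′∣ k<n)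

  take-injective : ∀ {a b} → a ≤ n → b ≤ n → take a 𝒯 ≡ take b 𝒯 → a ≡ b
  take-injective a≤n b≤n e =
    trans (sym (length-take-≤ 𝒯 a≤n)) (trans (cong length e) (length-take-≤ 𝒯 b≤n))

  drop-injective : ∀ {a b} → a ≤ n → b ≤ n → drop a 𝒯 ≡ drop b 𝒯 → a ≡ b
  drop-injective {a} {b} a≤n b≤n e =
    ∸-cancelˡ-≡ a≤n b≤n (trans (sym (length-drop a 𝒯)) (trans (cong length e) (length-drop b 𝒯)))

  suffix-not-proper-prefix : ∀ {i0 j0 z r} → i0 < n → j0 < n → drop i0 𝒯 ≢ drop j0 𝒯 ++ z ∷ r
  suffix-not-proper-prefix {i0} {j0} {z} {r} i0<n j0<n e =
    <-irrefl refl (All.lookup (Allₚ.drop⁺ i0 d<T′) (∈-before-last (drop i0 T′) (drop j0 T′) d-inside))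
    where
    open ≡-Reasoning
    d-inside : drop i0 T′ ∷ʳ d ≡ drop j0 T′ ++ d ∷ z ∷ r
    d-inside = begin
      drop i0 T′ ∷ʳ d            ≡⟨ sym (drop-𝒯 i0<n) ⟩
      drop i0 𝒯                  ≡⟨ e ⟩
      drop j0 𝒯 ++ z ∷ r         ≡⟨ cong (_++ z ∷ r) (drop-𝒯 j0<n) ⟩
      (drop j0 T′ ∷ʳ d) ++ z ∷ r ≡⟨ ++-assoc (drop j0 T′) (d ∷ []) (z ∷ r) ⟩
      drop j0 T′ ++ d ∷ z ∷ r    ∎

  suffix-mismatch : ∀ {j0 i0} → j0 < n → i0 < n → j0 ≢ i0 → Mismatch (drop j0 𝒯) (drop i0 𝒯)
  suffix-mismatch j0<n i0<n j0≢i0 = first-mismatch _ _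
    (j0≢i0 ∘ drop-injective (<⇒≤ j0<n) (<⇒≤ i0<n))
    (suffix-not-proper-prefix i0<n j0<n)
    (suffix-not-proper-prefix j0<n i0<n)

  ∈-idx : ∀ {j0} → j0 < n → suc j0 ∈ idx n
  ∈-idx j0<n = ∈-map⁺ suc (∈-upTo⁺ j0<n)

  lce-suc : ∀ {b i0} → b < n → i0 < n → letter b ≡ letter i0 → lce b i0 ≡ suc (lce (suc b) (suc i0))
  lce-suc {b} {i0} b<n i0<n same rewrite drop-at 𝒯 b<n | drop-at 𝒯 i0<n | same =
    lcp-++ (letter i0 ∷ []) (drop (suc b) 𝒯) (drop (suc i0) 𝒯)

  sub-pair : ∀ {k} → suc k < n → sub 𝒯 (suc k) (suc (suc k)) ≡ letter k ∷ letter (suc k) ∷ []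
  sub-pair {k} sk<n rewrite m+n∸n≡m 2 k | drop-at 𝒯 (<⇒≤ sk<n) | drop-at 𝒯 sk<n = refl

  module Order {_⊏_ : Rel (List ℕ) 0ℓ} (O : IsSuffixCompatible _⊏_) where
    open IsSuffixCompatible O

    infix 4 _◁_
    _◁_ : Rel ℕ 0ℓ
    a ◁ b = take a 𝒯 ⊏ take b 𝒯

    ◁-irrefl : ∀ {a} → ¬ a ◁ a
    ◁-irrefl = irrefl

    ◁-trans : Transitive _◁_
    ◁-trans = transitive

    ◁-connex : ∀ {a b} → a ≤ n → b ≤ n → a ≢ b → a ◁ b ⊎ b ◁ a
    ◁-connex {a} {b} a≤n b≤n a≢b with compare (take a 𝒯) (take b 𝒯)
    ... | tri< a◁b _ _ = inj₁ a◁b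
    ... | tri≈ _ e _   = ⊥-elim (a≢b (take-injective a≤n b≤n e))
    ... | tri> _ _ b◁a = inj₂ b◁a

    ◁-suc : ∀ {a b} → a < n → b < n → letter a ≡ letter b → a ◁ b ⇔ suc a ◁ suc b
    ◁-suc {a} {b} a<n b<n same rewrite take-at 𝒯 a<n | take-at 𝒯 b<n | same =
      mk⇔ (extend (letter b ∷ [])) (cancel (letter b ∷ []))

    StartsRun : ℕ → Set
    StartsRun a = a < n × HeadsRun _◁_ letter (_< n) a

    record IsLPF (i0 ℓ : ℕ) : Set where
      field
        bound    : ∀ {j0} → j0 < n → suc j0 ◁ suc i0 → lce j0 i0 ≤ ℓ
        attained : ℓ ≡ 0 ⊎ ∃[ j0 ] j0 < n × suc j0 ◁ suc i0 × lce j0 i0 ≡ ℓ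

    starts-run-without-match : ∀ {i0} → i0 < n → (∀ {j0} → j0 < n → suc j0 ◁ suc i0 → lce j0 i0 ≤ 0) →
                               StartsRun i0
    starts-run-without-match i0<n bound = i0<n , λ b<n b◁i0 same →
      ⊥-elim (n≮0 (subst (_≤ 0) (lce-suc b<n i0<n same) (bound b<n (to (◁-suc b<n i0<n same) b◁i0))))

    previous-match-beyond : ∀ {i0 b p c w y t} → i0 < n → b < n →
      drop i0 𝒯 ≡ (c ∷ w) ++ y ∷ t → letter b ≡ y →
      take b 𝒯 ≡ p ++ c ∷ w → take b 𝒯 ⊏ (take i0 𝒯 ++ c ∷ w) →
      ∃[ k0 ] k0 < n × suc k0 ◁ suc i0 × length (c ∷ w) < lce k0 i0
    previous-match-beyond {i0} {b} {p} {c} {w} {y} {t} i0<n b<n di b-letter tb≡ b◁i0W =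
      length p , p<n , to (◁-suc p<n i0<n (trans p-letter (sym i0-letter))) p◁i0 ,
      subst (length W <_) (sym lce≡) (m<m+n (length W) (s≤s z≤n))
      where
      open ≡-Reasoning
      W = c ∷ w
      tp : take (length p) 𝒯 ≡ p
      tp = proj₁ (split-after-prefix 𝒯 b tb≡)
      dp : drop (length p) 𝒯 ≡ W ++ drop b 𝒯
      dp = proj₂ (split-after-prefix 𝒯 b tb≡)
      p<n = proj₁ (drop-∷ 𝒯 (length p) dp)
      p-letter = proj₂ (drop-∷ 𝒯 (length p) dp)
      i0-letter = proj₂ (drop-∷ 𝒯 i0 di)
      p◁i0 : length p ◁ i0
      p◁i0 = subst (_⊏ take i0 𝒯) (sym tp) (cancel W (subst (_⊏ (take i0 𝒯 ++ W)) tb≡ b◁i0W))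
      lce≡ : lce (length p) i0 ≡ length W + suc (lcp (drop (suc b) 𝒯) t)
      lce≡ = begin
        lcp (drop (length p) 𝒯) (drop i0 𝒯)        ≡⟨ cong₂ lcp dp di ⟩
        lcp (W ++ drop b 𝒯) (W ++ y ∷ t)            ≡⟨ lcp-++ W (drop b 𝒯) (y ∷ t) ⟩
        length W + lcp (drop b 𝒯) (y ∷ t)
          ≡⟨ cong (λ s → length W + lcp s (y ∷ t))
                  (trans (drop-at 𝒯 b<n) (cong (_∷ drop (suc b) 𝒯) b-letter)) ⟩
        length W + lcp (y ∷ drop (suc b) 𝒯) (y ∷ t)
          ≡⟨ cong (length W +_) (lcp-++ (y ∷ []) (drop (suc b) 𝒯) t) ⟩
        length W + suc (lcp (drop (suc b) 𝒯) t)     ∎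

    starts-run-after-mismatch : ∀ {j0 i0 c w x y s t} → j0 < n → i0 < n → x ≢ y →
      drop j0 𝒯 ≡ (c ∷ w) ++ x ∷ s → drop i0 𝒯 ≡ (c ∷ w) ++ y ∷ t → suc j0 ◁ suc i0 →
      (∀ {k0} → k0 < n → suc k0 ◁ suc i0 → lce k0 i0 ≤ length (c ∷ w)) →
      StartsRun (i0 + length (c ∷ w))
    starts-run-after-mismatch {j0} {i0} {c} {w} j0<n i0<n x≢y dj di sj◁si bound = a<n , heads
      where
      W = c ∷ w
      u = j0 + length W
      a = i0 + length W
      u<n = proj₁ (drop-∷ 𝒯 u (drop-after 𝒯 j0 dj))
      u-letter = proj₂ (drop-∷ 𝒯 u (drop-after 𝒯 j0 dj))
      a<n = proj₁ (drop-∷ 𝒯 a (drop-after 𝒯 i0 di))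
      a-letter = proj₂ (drop-∷ 𝒯 a (drop-after 𝒯 i0 di))
      tu : take u 𝒯 ≡ take j0 𝒯 ++ W
      tu = take-after 𝒯 j0 dj
      ta : take a 𝒯 ≡ take i0 𝒯 ++ W
      ta = take-after 𝒯 i0 di
      j0◁i0 : j0 ◁ i0
      j0◁i0 = from (◁-suc j0<n i0<n (trans (proj₂ (drop-∷ 𝒯 j0 dj)) (sym (proj₂ (drop-∷ 𝒯 i0 di)))))
                   sj◁si
      u◁a : u ◁ a
      u◁a = subst₂ _⊏_ (sym tu) (sym ta) (extend W j0◁i0)
      heads : HeadsRun _◁_ letter (_< n) a
      heads {b} b<n b◁a same with b ≟ u
      ... | yes refl = ⊥-elim (x≢y (trans (sym u-letter) (trans same a-letter)))
      ... | no b≢u with ◁-connex (<⇒≤ b<n) (<⇒≤ u<n) b≢u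
      ...   | inj₁ b◁u = u , u<n , b◁u , u◁a
      ...   | inj₂ u◁b
              with p , tb≡ ← convex W (subst (_⊏ take b 𝒯) tu u◁b) (subst (take b 𝒯 ⊏_) ta b◁a)
              with k0 , k0<n , sk◁si , W<lce ←
                     previous-match-beyond i0<n b<n di (trans same a-letter) tb≡ (subst (take b 𝒯 ⊏_) ta b◁a)
              = ⊥-elim (<⇒≱ W<lce (bound k0<n sk◁si))

    LPF-zero-starts-run : ∀ {i0 ℓ} → i0 < n → IsLPF i0 ℓ → ℓ ≡ 0 → StartsRun (i0 + ℓ)
    LPF-zero-starts-run {i0} i0<n lpf refl =
      subst StartsRun (sym (+-identityʳ i0)) (starts-run-without-match i0<n (IsLPF.bound lpf))

    LPF-starts-run : ∀ {i0 ℓ} → i0 < n → IsLPF i0 ℓ → StartsRun (i0 + ℓ)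
    LPF-starts-run {i0} {ℓ} i0<n lpf with IsLPF.attained lpf
    ... | inj₁ ℓ≡0 = LPF-zero-starts-run i0<n lpf ℓ≡0
    ... | inj₂ (j0 , j0<n , sj◁si , lce≡ℓ) with suffix-mismatch j0<n i0<n (λ { refl → ◁-irrefl sj◁si })
    ...   | m@(mismatch [] _ _ _) = LPF-zero-starts-run i0<n lpf (trans (sym lce≡ℓ) (Mismatch.lcp≡ m))
    ...   | m@(mismatch (c ∷ w) x≢y dj di) =
      subst (StartsRun ∘ (i0 +_)) W≡ℓ
        (starts-run-after-mismatch j0<n i0<n x≢y dj di sj◁si
          (λ {k0} k0<n sk◁si → subst (lce k0 i0 ≤_) (sym W≡ℓ) (IsLPF.bound lpf k0<n sk◁si)))
      where
      W≡ℓ : length (c ∷ w) ≡ ℓ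
      W≡ℓ = trans (sym (Mismatch.lcp≡ m)) lce≡ℓ

    record Ranks (π : ℕ → ℕ) : Set where
      field
        range    : ∀ {i0} → i0 < n → 1 ≤ π (suc i0) × π (suc i0) ≤ n
        monotone : ∀ {i0 j0} → i0 < n → j0 < n → suc i0 ◁ suc j0 → π (suc i0) < π (suc j0)

      reflects : ∀ {i0 j0} → i0 < n → j0 < n → π (suc i0) < π (suc j0) → suc i0 ◁ suc j0
      reflects {i0} {j0} i0<n j0<n πi<πj with suc i0 ≟ suc j0
      ... | yes refl = ⊥-elim (<-irrefl refl πi<πj)
      ... | no i≢j with ◁-connex i0<n j0<n i≢j
      ...   | inj₁ i◁j = i◁j
      ...   | inj₂ j◁i = ⊥-elim (<-asym πi<πj (monotone j0<n i0<n j◁i))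

    module _ {π : ℕ → ℕ} (ranks : Ranks π) where
      open Ranks ranks

      ranks⇒IsPerm : IsPerm n π
      ranks⇒IsPerm = (λ { (suc i0) _ i≤n → range i≤n }) , injective
        where
        injective : ∀ i j → 1 ≤ i → i ≤ n → 1 ≤ j → j ≤ n → π i ≡ π j → i ≡ j
        injective (suc i0) (suc j0) _ i≤n _ j≤n πi≡πj with suc i0 ≟ suc j0
        ... | yes i≡j = i≡j
        ... | no i≢j with ◁-connex i≤n j≤n i≢j
        ...   | inj₁ i◁j = ⊥-elim (<-irrefl πi≡πj (monotone i≤n j≤n i◁j))
        ...   | inj₂ j◁i = ⊥-elim (<-irrefl (sym πi≡πj) (monotone j≤n i≤n j◁i))

      ranks⇒OrderPreserving : OrderPreserving 𝒯 π
      ranks⇒OrderPreserving (suc i0) (suc j0) _ i<n _ j<n πi<πj same-pair =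
        monotone i<n j<n (to (◁-suc i<n j<n next-letter) (reflects (<⇒≤ i<n) (<⇒≤ j<n) πi<πj))
        where
        next-letter : letter (suc i0) ≡ letter (suc j0)
        next-letter = ∷-injectiveˡ (∷-injectiveʳ (trans (sym (sub-pair i<n)) (trans same-pair (sub-pair j<n))))

      LPF-isLPF : ∀ {i0} → i0 < n → IsLPF i0 (LPF 𝒯 π (suc i0))
      LPF-isLPF {i0} i0<n = record { bound = bound ; attained = attained }
        where
        earlier : ℕ → Bool
        earlier j = π j <ᵇ π (suc i0)

        match : ℕ → ℕ
        match j = rlce 𝒯 j (suc i0)

        bound : ∀ {j0} → j0 < n → suc j0 ◁ suc i0 → lce j0 i0 ≤ LPF 𝒯 π (suc i0)
        bound {j0} j0<n sj◁si with LPF-cases 𝒯 π (suc i0)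
        ... | inj₁ (πi≡1 , _) = ⊥-elim (<⇒≱ (subst (π (suc j0) <_) πi≡1 πj<πi) (proj₁ (range j0<n)))
          where πj<πi = monotone j0<n i0<n sj◁si
        ... | inj₂ LPF≡ = subst (lce j0 i0 ≤_) (sym LPF≡)
          (≤-maxL (∈-map⁺ match (∈-filter⁺ (T? ∘ earlier) (∈-idx j0<n)
                                            (<⇒<ᵇ (monotone j0<n i0<n sj◁si)))))

        attained : LPF 𝒯 π (suc i0) ≡ 0 ⊎
                   ∃[ j0 ] j0 < n × suc j0 ◁ suc i0 × lce j0 i0 ≡ LPF 𝒯 π (suc i0)
        attained with LPF-cases 𝒯 π (suc i0)
        ... | inj₁ (_ , LPF≡0) = inj₁ LPF≡0
        ... | inj₂ LPF≡ with maxL-attained (map match (filterᵇ earlier (idx n)))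
        ...   | inj₁ max≡0 = inj₁ (trans LPF≡ max≡0)
        ...   | inj₂ max∈ with j , j∈ , max≡ ← ∈-map⁻ match max∈
                          with j∈idx , j-earlier ← ∈-filter⁻ (T? ∘ earlier) {xs = idx n} j∈
                          with j0 , j0∈ , refl ← ∈-map⁻ suc j∈idx =
          inj₂ (j0 , ∈-upTo⁻ j0∈ , reflects (∈-upTo⁻ j0∈) i0<n (<ᵇ⇒< _ _ j-earlier) ,
                sym (trans LPF≡ max≡))

      PDA-length-≤ : ∀ S → AllPairs _◁_ S → (∀ {a} → a ∈ S ⇔ a < n) →
                     length (PDA 𝒯 π) ≤ runs (map letter S)
      PDA-length-≤ S sorted ∈S = begin
        length (PDA 𝒯 π)                     ≡⟨ ↭-length (sortBy-↭ _ ends) ⟩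
        length ends                          ≤⟨ Unique-⊆⇒length-≤ (deduplicate-! _≟_ _) ends⊆ ⟩
        length (map suc (runHeads letter S)) ≡⟨ length-map suc (runHeads letter S) ⟩
        length (runHeads letter S)           ≡⟨ length-runHeads letter S ⟩
        runs (map letter S)                  ∎
        where
        open ≤-Reasoning
        ends : List ℕ
        ends = deduplicate _≟_ (map (λ i → i + LPF 𝒯 π i) (idx n))
        ends⊆ : ends ⊆ map suc (runHeads letter S)
        ends⊆ k∈ with i , i∈ , refl ← ∈-map⁻ _ (∈-deduplicate⁻ _≟_ _ k∈)
                 with i0 , i0∈ , refl ← ∈-map⁻ suc i∈
                 with a<n , heads ← LPF-starts-run (∈-upTo⁻ i0∈) (LPF-isLPF (∈-upTo⁻ i0∈)) =
          ∈-map⁺ suc (heads-run⇒∈-runHeads ◁-irrefl ◁-trans letter S sorted ∈S (from ∈S a<n) heads)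

  module Asc = Order colex-isSuffixCompatible
  module Desc = Order (flip-isSuffixCompatible colex-isSuffixCompatible)

  colexᵇ : ℕ → ℕ → Bool
  colexᵇ a b = colexLt (take a 𝒯) (take b 𝒯)

  colexᵇ⇔◁ : ∀ a b → T (colexᵇ a b) ⇔ a Asc.◁ b
  colexᵇ⇔◁ a b = colexLt⇔Colex (take a 𝒯) (take b 𝒯)

  length-idx : length (idx n) ≡ n
  length-idx = trans (length-map suc (upTo n)) (length-upTo n)

  below : ℕ → ℕ → Bool
  below i k = colexᵇ k i

  ¬below-self : ∀ i → ¬ T (below i i)
  ¬below-self i = Asc.◁-irrefl {i} ∘ to (colexᵇ⇔◁ i i)

  IPA-≤ : ∀ {i0} → i0 < n → IPA 𝒯 (suc i0) ≤ n
  IPA-≤ {i0} i0<n = subst (IPA 𝒯 (suc i0) ≤_) (trans (count-true (idx n)) length-idx)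
    (count-< (below (suc i0)) (λ _ → true) (idx n) (λ _ _ → _) (∈-idx i0<n) (¬below-self (suc i0)) _)

  IPA-monotone : ∀ {i0 j0} → i0 < n → j0 < n → suc i0 Asc.◁ suc j0 → IPA 𝒯 (suc i0) < IPA 𝒯 (suc j0)
  IPA-monotone {i0} {j0} i0<n j0<n i◁j = s≤s (count-< (below (suc i0)) (below (suc j0)) (idx n)
    below-i⇒below-j (∈-idx i0<n) (¬below-self (suc i0)) (from (colexᵇ⇔◁ (suc i0) (suc j0)) i◁j))
    where
    below-i⇒below-j : ∀ {k} → k ∈ idx n → T (below (suc i0) k) → T (below (suc j0) k)
    below-i⇒below-j {k} _ k◁i =
      from (colexᵇ⇔◁ k (suc j0)) (Asc.◁-trans {k} {suc i0} {suc j0} (to (colexᵇ⇔◁ k (suc i0)) k◁i) i◁j)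

  IPA-ranks : Asc.Ranks (IPA 𝒯)
  IPA-ranks = record { range = λ i0<n → s≤s z≤n , IPA-≤ i0<n ; monotone = IPA-monotone }

  piBar-ranks : Desc.Ranks (piBar 𝒯)
  piBar-ranks = record
    { range    = λ {i0} i0<n →
        m<n⇒0<n∸m (s≤s (IPA-≤ i0<n)) , ∸-monoʳ-≤ {n = IPA 𝒯 (suc i0)} (suc n) (s≤s z≤n)
    ; monotone = λ i0<n j0<n sj◁si → ∸-monoʳ-< (IPA-monotone j0<n i0<n sj◁si) (m≤n⇒m≤1+n (IPA-≤ i0<n))
    }

  sortedPrefixes : List ℕ
  sortedPrefixes = sortBy colexᵇ (upTo n)

  ∈-sortedPrefixes : ∀ {a} → a ∈ sortedPrefixes ⇔ a < n
  ∈-sortedPrefixes = mk⇔ (∈-upTo⁻ ∘ ∈-resp-↭ (sortBy-↭ colexᵇ (upTo n)))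
                         (∈-resp-↭ (↭-sym (sortBy-↭ colexᵇ (upTo n))) ∘ ∈-upTo⁺)

  sortedPrefixes-sorted : AllPairs Asc._◁_ sortedPrefixes
  sortedPrefixes-sorted =
    sortBy-sorted colexᵇ {_<_ = Asc._◁_} (λ {a} {b} → colexᵇ⇔◁ a b) (λ {i j k} → Asc.◁-trans {i} {j} {k})
    (AllPairs.applyUpTo⁺₁ (λ a → a) n
      (λ i<j j<n → Asc.◁-connex (<⇒≤ (<-trans i<j j<n)) (<⇒≤ j<n) (<⇒≢ i<j)))

  d<prefix : ∀ {a} → a < n → All (d <_) (reverse (take a 𝒯))
  d<prefix {a} a<n = All.tabulate (λ x∈ → All.lookup d<take (Any.reverse⁻ x∈))
    where
    d<take : All (d <_) (take a 𝒯)
    d<take = subst (All (d <_)) (sym (take-𝒯 a<n)) (Allₚ.take⁺ a d<T′)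

  reverse-rotation : ∀ {a} → a < n →
                     reverse (rot 𝒯 (suc a)) ≡ reverse (take a 𝒯) ++ d ∷ reverse (drop a T′)
  reverse-rotation {a} a<n = begin
    reverse (drop a 𝒯 ++ take a 𝒯)                 ≡⟨ reverse-++ (drop a 𝒯) (take a 𝒯) ⟩
    reverse (take a 𝒯) ++ reverse (drop a 𝒯)
      ≡⟨ cong (λ s → reverse (take a 𝒯) ++ reverse s) (drop-𝒯 a<n) ⟩
    reverse (take a 𝒯) ++ reverse (drop a T′ ∷ʳ d)
      ≡⟨ cong (reverse (take a 𝒯) ++_) (reverse-++ (drop a T′) (d ∷ [])) ⟩
    reverse (take a 𝒯) ++ d ∷ reverse (drop a T′)   ∎
    where open ≡-Reasoning

  rotation-colexᵇ : ∀ {a b} → a < n → b < n → colexLt (rot 𝒯 (suc a)) (rot 𝒯 (suc b)) ≡ colexᵇ a b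
  rotation-colexᵇ {a} {b} a<n b<n with a ≟ b
  ... | yes refl = trans (lexLt-irrefl (reverse (rot 𝒯 (suc a)))) (sym (lexLt-irrefl (reverse (take a 𝒯))))
  ... | no a≢b = trans (cong₂ lexLt (reverse-rotation a<n) (reverse-rotation b<n))
    (lexLt-sentinel _ _ (d<prefix a<n) (d<prefix b<n)
      (a≢b ∘ take-injective (<⇒≤ a<n) (<⇒≤ b<n) ∘ reverse-injective))

  head-rotation : ∀ {a} → a < n → headD (rot 𝒯 (suc a)) ≡ letter a
  head-rotation {a} a<n = cong (λ s → headD (s ++ take a 𝒯)) (drop-at 𝒯 a<n)

  rbar≡ : rbar 𝒯 ≡ runs (map letter sortedPrefixes)
  rbar≡ = cong runs (begin
    map headD (sortBy colexLt (map (rot 𝒯) (map suc (upTo n))))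
      ≡⟨ cong (map headD ∘ sortBy colexLt) (sym (map-∘ (upTo n))) ⟩
    map headD (sortBy colexLt (map (rot 𝒯 ∘ suc) (upTo n)))
      ≡⟨ cong (map headD)
              (sortBy-map (rot 𝒯 ∘ suc) colexLt colexᵇ rotation-colexᵇ (All.tabulate ∈-upTo⁻)) ⟩
    map headD (map (rot 𝒯 ∘ suc) sortedPrefixes)
      ≡⟨ sym (map-∘ sortedPrefixes) ⟩
    map (headD ∘ rot 𝒯 ∘ suc) sortedPrefixes
      ≡⟨ map-cong-local (All.tabulate (head-rotation ∘ to ∈-sortedPrefixes)) ⟩
    map letter sortedPrefixes ∎)
    where open ≡-Reasoning

  PDA-IPA-≤-rbar : length (PDA 𝒯 (piIPA 𝒯)) ≤ rbar 𝒯
  PDA-IPA-≤-rbar = subst (length (PDA 𝒯 (piIPA 𝒯)) ≤_) (sym rbar≡)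
    (Asc.PDA-length-≤ IPA-ranks sortedPrefixes sortedPrefixes-sorted ∈-sortedPrefixes)

  PDA-piBar-≤-rbar : length (PDA 𝒯 (piBar 𝒯)) ≤ rbar 𝒯
  PDA-piBar-≤-rbar = subst (length (PDA 𝒯 (piBar 𝒯)) ≤_) (trans runs-reversed (sym rbar≡))
    (Desc.PDA-length-≤ piBar-ranks (reverse sortedPrefixes) (AllPairs-reverse sortedPrefixes-sorted)
      (mk⇔ (to ∈-sortedPrefixes ∘ Any.reverse⁻) (Any.reverse⁺ ∘ from ∈-sortedPrefixes)))
    where
    runs-reversed : runs (map letter (reverse sortedPrefixes)) ≡ runs (map letter sortedPrefixes)
    runs-reversed = trans (cong runs (reverse-map letter sortedPrefixes)) (runs-reverse (map letter sortedPrefixes))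

lemma42 : (T : List ℕ) → IsText T →
    IsPerm (length T) (piIPA T) × IsPerm (length T) (piBar T) ×
    OrderPreserving T (piIPA T) × OrderPreserving T (piBar T) ×
    (length (PDA T (piIPA T)) ≤ rbar T) × (length (PDA T (piBar T)) ≤ rbar T)
lemma42 T isText with T′ , d , refl , d<T′ ← split-sentinel {T} isText =
  let open Text T′ d d<T′ in
  Asc.ranks⇒IsPerm IPA-ranks , Desc.ranks⇒IsPerm piBar-ranks ,
  Asc.ranks⇒OrderPreserving IPA-ranks , Desc.ranks⇒OrderPreserving piBar-ranks ,
  PDA-IPA-≤-rbar , PDA-piBar-≤-rbar
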